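{- Let $k\ge 1$ be an integer and let ${n\brace k}$ denote the Stirling numbers of the second kind. For $1\le r\le k$ put \[A_{k,r}=\frac{(-1)^{k-r}r^k}{k!}\binom{k}{r}.\] Then for all complex $x$ with $|x|<1/k^2$, \[\sum_{n\ge k}{n\brace k}^{2}x^n \;=\; x^k\sum_{r=1}^{k}\sum_{s=1}^{k}\frac{A_{k,r}A_{k,s}}{1-rsx}.\]
   Context: ${n\brace k}$ is the number of partitions of an $n$-element set into $k$ nonempty blocks. -}

module Defs where

open import Data.Nat as ℕ using (ℕ; zero; suc; _∸_; _!)
open import Data.Nat.Properties using (_!≢0)
open import Data.Nat.Combinatorics using (_C_)
open import Data.Integer as ℤ using (ℤ)
open import Data.Rational as ℚ using (ℚ; 0ℚ; 1ℚ; _+_; _*_; _/_)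

S : ℕ → ℕ → ℕ
S zero    zero    = 1
S zero    (suc k) = 0
S (suc n) zero    = 0
S (suc n) (suc k) = suc k ℕ.* S n (suc k) ℕ.+ S n k

A : ℕ → ℕ → ℚ
A k r = ((ℤ.- ℤ.1ℤ) ℤ.^ (k ∸ r) ℤ.* ℤ.+ (r ℕ.^ k ℕ.* (k C r))) / (k !)
  where instance _ = k !≢0

Σ₁ : ℕ → (ℕ → ℚ) → ℚ
Σ₁ zero    f = 0ℚ
Σ₁ (suc k) f = Σ₁ k f + f (suc k)

-- Formal power series over ℚ, as coefficient sequences.
Series : Set
Series = ℕ → ℚ

shiftX : ℕ → Series → Series
shiftX zero    f n       = f n
shiftX (suc k) f zero    = 0ℚ
shiftX (suc k) f (suc n) = shiftX k f n

ΣSeries : ℕ → (ℕ → Series) → Series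
ΣSeries k F n = Σ₁ k (λ r → F r n)

scale : ℚ → Series → Series
scale c f n = c * f n

-- 1 / (1 - c x) = sum_n c^n x^n   (c a natural number)
geom : ℕ → Series
geom c n = (ℤ.+ (c ℕ.^ n)) / 1

lhsSeries : ℕ → Series
lhsSeries k = shiftX k (λ m → (ℤ.+ (S (m ℕ.+ k) k ℕ.* S (m ℕ.+ k) k)) / 1)

rhsSeries : ℕ → Series
rhsSeries k = shiftX k (ΣSeries k (λ r → ΣSeries k (λ s →
                scale (A k r * A k s) (geom (r ℕ.* s)))))

-- The coefficient of x^(m+k) on the right is (Σ_r A_{k,r} r^m)², so it suffices that
-- Σ_{r=1}^k A_{k,r} r^m = {m+k brace k}.  This is the explicit formula
-- k! {n brace k} = Σ_{r=0}^k (-1)^(k-r) C(k,r) r^n at n = m + k (its r = 0 term vanishes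
-- since n ≥ 1), which follows by induction from the recurrence for {n brace k}: Pascal's
-- rule and the absorption identity (j+1) C(k+1,j+1) = (k+1) C(k,j) turn the alternating
-- binomial sums of r ↦ r^(n+1) into those of r ↦ r^n.
module Submission where

open import Defs
open import Data.Nat using (ℕ; _≤_)
open import Relation.Binary.PropositionalEquality using (_≡_)

open import Data.Nat as ℕ using (zero; suc; _!; _∸_; s≤s; z≤n)
import Data.Nat.Properties as ℕ
open import Data.Nat.Properties using (_!≢0)
open import Data.Nat.Combinatorics using (_C_; nCk+nC[k+1]≡[n+1]C[k+1]; k>n⇒nCk≡0; nC1≡n)
import Data.Nat.Tactic.RingSolver as ℕ-Solver
open import Data.Integer as ℤ using (ℤ; +_)
import Data.Integer.Properties as ℤ
open import Data.Integer.Tactic.RingSolver using (solve-∀)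
open import Data.Rational using (ℚ; _+_; _*_; _/_; toℚᵘ)
import Data.Rational.Properties as ℚ
open import Data.Rational.Unnormalised as ℚᵘ using (mkℚᵘ; *≡*)
import Data.Rational.Unnormalised.Properties as ℚᵘ
open import Function using (_∘_)
open import Algebra.Bundles using (CommutativeMonoid)
import Algebra.Properties.CommutativeSemigroup as CommSemigroup
open import Relation.Binary.PropositionalEquality using (refl; sym; trans; cong; cong₂; module ≡-Reasoning)

sgn : ℕ → ℤ
sgn r = ℤ.-1ℤ ℤ.^ r

Σ₀ : ℕ → (ℕ → ℤ) → ℤ
Σ₀ zero    f = f 0
Σ₀ (suc k) f = Σ₀ k f ℤ.+ f (suc k)

Σ₀-cong : ∀ k {f g : ℕ → ℤ} → (∀ r → r ≤ k → f r ≡ g r) → Σ₀ k f ≡ Σ₀ k g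
Σ₀-cong zero    f≡g = f≡g 0 z≤n
Σ₀-cong (suc k) f≡g =
  cong₂ ℤ._+_ (Σ₀-cong k (λ r r≤k → f≡g r (ℕ.m≤n⇒m≤1+n r≤k))) (f≡g (suc k) ℕ.≤-refl)

Σ₀-suc : ∀ k f → Σ₀ (suc k) f ≡ f 0 ℤ.+ Σ₀ k (f ∘ suc)
Σ₀-suc zero    f = refl
Σ₀-suc (suc k) f = trans (cong (ℤ._+ f (suc (suc k))) (Σ₀-suc k f)) (ℤ.+-assoc (f 0) _ _)

Σ₀-distrib-+ : ∀ k f g → Σ₀ k (λ r → f r ℤ.+ g r) ≡ Σ₀ k f ℤ.+ Σ₀ k g
Σ₀-distrib-+ zero    f g = refl
Σ₀-distrib-+ (suc k) f g = begin
  Σ₀ k (λ r → f r ℤ.+ g r) ℤ.+ (f (suc k) ℤ.+ g (suc k))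
    ≡⟨ cong (ℤ._+ (f (suc k) ℤ.+ g (suc k))) (Σ₀-distrib-+ k f g) ⟩
  (Σ₀ k f ℤ.+ Σ₀ k g) ℤ.+ (f (suc k) ℤ.+ g (suc k))
    ≡⟨ CommSemigroup.interchange ℤ.+-commutativeSemigroup (Σ₀ k f) (Σ₀ k g) (f (suc k)) (g (suc k)) ⟩
  Σ₀ (suc k) f ℤ.+ Σ₀ (suc k) g ∎
  where open ≡-Reasoning

*-distribˡ-Σ₀ : ∀ k c f → c ℤ.* Σ₀ k f ≡ Σ₀ k (λ r → c ℤ.* f r)
*-distribˡ-Σ₀ zero    c f = refl
*-distribˡ-Σ₀ (suc k) c f =
  trans (ℤ.*-distribˡ-+ c (Σ₀ k f) (f (suc k))) (cong (ℤ._+ c ℤ.* f (suc k)) (*-distribˡ-Σ₀ k c f))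

[k+1]*[n+1]C[k+1]≡[n+1]*nCk : ∀ n k → suc k ℕ.* (suc n C suc k) ≡ suc n ℕ.* (n C k)
[k+1]*[n+1]C[k+1]≡[n+1]*nCk zero    zero    = refl
[k+1]*[n+1]C[k+1]≡[n+1]*nCk zero    (suc k) = ℕ.*-zeroʳ (suc (suc k))
[k+1]*[n+1]C[k+1]≡[n+1]*nCk (suc n) zero    =
  trans (ℕ.+-identityʳ _) (trans (nC1≡n (suc (suc n))) (sym (ℕ.*-identityʳ (suc (suc n)))))
[k+1]*[n+1]C[k+1]≡[n+1]*nCk (suc n) (suc k) = begin
  suc K ℕ.* (suc N C suc K)
    ≡⟨ cong (suc K ℕ.*_) (pascal N K) ⟩
  suc K ℕ.* (N C K ℕ.+ N C suc K)
    ≡⟨ split K (N C K) (N C suc K) ⟩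
  K ℕ.* (N C K) ℕ.+ N C K ℕ.+ suc K ℕ.* (N C suc K)
    ≡⟨ cong₂ (λ a b → a ℕ.+ N C K ℕ.+ b) ([k+1]*[n+1]C[k+1]≡[n+1]*nCk n k)
                                         ([k+1]*[n+1]C[k+1]≡[n+1]*nCk n K) ⟩
  N ℕ.* (n C k) ℕ.+ N C K ℕ.+ N ℕ.* (n C K)
    ≡⟨ cong (λ a → N ℕ.* (n C k) ℕ.+ a ℕ.+ N ℕ.* (n C K)) (pascal n k) ⟩
  N ℕ.* (n C k) ℕ.+ (n C k ℕ.+ n C K) ℕ.+ N ℕ.* (n C K)
    ≡⟨ merge N (n C k) (n C K) ⟩
  suc N ℕ.* (n C k ℕ.+ n C K)
    ≡⟨ cong (suc N ℕ.*_) (pascal n k) ⟨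
  suc N ℕ.* (N C K) ∎
  where
  open ≡-Reasoning
  N = suc n
  K = suc k
  pascal : ∀ m j → suc m C suc j ≡ m C j ℕ.+ m C suc j
  pascal m j = sym (nCk+nC[k+1]≡[n+1]C[k+1] m j)
  split : ∀ j a b → suc j ℕ.* (a ℕ.+ b) ≡ j ℕ.* a ℕ.+ a ℕ.+ suc j ℕ.* b
  split = ℕ-Solver.solve-∀
  merge : ∀ m a b → m ℕ.* a ℕ.+ (a ℕ.+ b) ℕ.+ m ℕ.* b ≡ suc m ℕ.* (a ℕ.+ b)
  merge = ℕ-Solver.solve-∀

^-distribʳ-* : ∀ a b m → (a ℕ.* b) ℕ.^ m ≡ a ℕ.^ m ℕ.* b ℕ.^ m
^-distribʳ-* a b zero    = refl
^-distribʳ-* a b (suc m) =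
  trans (cong (a ℕ.* b ℕ.*_) (^-distribʳ-* a b m))
        (CommSemigroup.interchange ℕ.*-commutativeSemigroup a b _ _)

-- (-1)^k times the k-th forward difference of f at 0.
Δ : ℕ → (ℕ → ℤ) → ℤ
Δ k f = Σ₀ k (λ r → sgn r ℤ.* (+ (k C r) ℤ.* f r))

Δ-cong : ∀ k {f g : ℕ → ℤ} → (∀ r → f r ≡ g r) → Δ k f ≡ Δ k g
Δ-cong k f≡g = Σ₀-cong k (λ r _ → cong (λ x → sgn r ℤ.* (+ (k C r) ℤ.* x)) (f≡g r))

Δ-suc : ∀ k f → Δ (suc k) f ≡ Δ k f ℤ.- Δ k (f ∘ suc)
Δ-suc k f = begin
  Δ (suc k) f
    ≡⟨ Σ₀-suc k _ ⟩
  t₀ ℤ.+ Σ₀ k (λ j → sgn (suc j) ℤ.* (+ (suc k C suc j) ℤ.* f (suc j)))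
    ≡⟨ cong (λ z → t₀ ℤ.+ z) (trans (Σ₀-cong k (λ j _ → pascal j)) (Σ₀-distrib-+ k _ _)) ⟩
  t₀ ℤ.+ (upper ℤ.+ Σ₀ k (λ j → ℤ.-1ℤ ℤ.* (sgn j ℤ.* (+ (k C j) ℤ.* f (suc j)))))
    ≡⟨ cong (λ z → t₀ ℤ.+ (upper ℤ.+ z)) (*-distribˡ-Σ₀ k ℤ.-1ℤ _) ⟨
  t₀ ℤ.+ (upper ℤ.+ ℤ.-1ℤ ℤ.* Δ k (f ∘ suc))
    ≡⟨ regroup t₀ upper (Δ k (f ∘ suc)) ⟩
  (t₀ ℤ.+ upper) ℤ.- Δ k (f ∘ suc)
    ≡⟨ cong (ℤ._- Δ k (f ∘ suc)) (trans (sym top-vanishes) (Σ₀-suc k _)) ⟨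
  Δ k f ℤ.- Δ k (f ∘ suc) ∎
  where
  open ≡-Reasoning
  t₀ = sgn 0 ℤ.* (+ 1 ℤ.* f 0)
  upper = Σ₀ k (λ j → sgn (suc j) ℤ.* (+ (k C suc j) ℤ.* f (suc j)))
  top-vanishes : Σ₀ (suc k) (λ r → sgn r ℤ.* (+ (k C r) ℤ.* f r)) ≡ Δ k f
  top-vanishes rewrite k>n⇒nCk≡0 (ℕ.n<1+n k) | ℤ.*-zeroʳ (sgn (suc k)) = ℤ.+-identityʳ (Δ k f)
  pascal : ∀ j → sgn (suc j) ℤ.* (+ (suc k C suc j) ℤ.* f (suc j))
               ≡ sgn (suc j) ℤ.* (+ (k C suc j) ℤ.* f (suc j))
                 ℤ.+ ℤ.-1ℤ ℤ.* (sgn j ℤ.* (+ (k C j) ℤ.* f (suc j)))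
  pascal j rewrite sym (nCk+nC[k+1]≡[n+1]C[k+1] k j) | ℤ.pos-+ (k C j) (k C suc j) =
    distribute (sgn j) (+ (k C j)) (+ (k C suc j)) (f (suc j))
    where
    distribute : ∀ s a b x → (ℤ.-1ℤ ℤ.* s) ℤ.* ((a ℤ.+ b) ℤ.* x)
                            ≡ (ℤ.-1ℤ ℤ.* s) ℤ.* (b ℤ.* x) ℤ.+ ℤ.-1ℤ ℤ.* (s ℤ.* (a ℤ.* x))
    distribute = solve-∀
  regroup : ∀ x p d → x ℤ.+ (p ℤ.+ ℤ.-1ℤ ℤ.* d) ≡ (x ℤ.+ p) ℤ.- d
  regroup = solve-∀

Δ-suc-*r : ∀ k g → Δ (suc k) (λ r → + r ℤ.* g r) ≡ ℤ.- (+ suc k ℤ.* Δ k (g ∘ suc))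
Δ-suc-*r k g = begin
  Δ (suc k) (λ r → + r ℤ.* g r)
    ≡⟨ Σ₀-suc k _ ⟩
  ℤ.0ℤ ℤ.+ Σ₀ k (λ j → sgn (suc j) ℤ.* (+ (suc k C suc j) ℤ.* (+ suc j ℤ.* g (suc j))))
    ≡⟨ trans (ℤ.+-identityˡ _) (Σ₀-cong k (λ j _ → absorb j)) ⟩
  Σ₀ k (λ j → ℤ.- + suc k ℤ.* (sgn j ℤ.* (+ (k C j) ℤ.* g (suc j))))
    ≡⟨ *-distribˡ-Σ₀ k (ℤ.- + suc k) _ ⟨
  ℤ.- + suc k ℤ.* Δ k (g ∘ suc)
    ≡⟨ ℤ.neg-distribˡ-* (+ suc k) _ ⟨
  ℤ.- (+ suc k ℤ.* Δ k (g ∘ suc)) ∎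
  where
  open ≡-Reasoning
  absorb : ∀ j → sgn (suc j) ℤ.* (+ (suc k C suc j) ℤ.* (+ suc j ℤ.* g (suc j)))
               ≡ ℤ.- + suc k ℤ.* (sgn j ℤ.* (+ (k C j) ℤ.* g (suc j)))
  absorb j = begin
    sgn (suc j) ℤ.* (+ (suc k C suc j) ℤ.* (+ suc j ℤ.* g (suc j)))
      ≡⟨ cong (sgn (suc j) ℤ.*_) (ℤ.*-assoc (+ (suc k C suc j)) (+ suc j) (g (suc j))) ⟨
    sgn (suc j) ℤ.* (+ (suc k C suc j) ℤ.* + suc j ℤ.* g (suc j))
      ≡⟨ cong (λ c → sgn (suc j) ℤ.* (c ℤ.* g (suc j))) coefficient ⟩
    sgn (suc j) ℤ.* (+ suc k ℤ.* + (k C j) ℤ.* g (suc j))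
      ≡⟨ regroup (sgn j) (+ suc k) (+ (k C j)) (g (suc j)) ⟩
    ℤ.- + suc k ℤ.* (sgn j ℤ.* (+ (k C j) ℤ.* g (suc j))) ∎
    where
    coefficient : + (suc k C suc j) ℤ.* + suc j ≡ + suc k ℤ.* + (k C j)
    coefficient = begin
      + (suc k C suc j) ℤ.* + suc j     ≡⟨ ℤ.pos-* (suc k C suc j) (suc j) ⟨
      + ((suc k C suc j) ℕ.* suc j)     ≡⟨ cong +_ (ℕ.*-comm (suc k C suc j) (suc j)) ⟩
      + (suc j ℕ.* (suc k C suc j))     ≡⟨ cong +_ ([k+1]*[n+1]C[k+1]≡[n+1]*nCk k j) ⟩
      + (suc k ℕ.* (k C j))             ≡⟨ ℤ.pos-* (suc k) (k C j) ⟩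
      + suc k ℤ.* + (k C j)             ∎
    regroup : ∀ s K c x → (ℤ.-1ℤ ℤ.* s) ℤ.* (K ℤ.* c ℤ.* x) ≡ ℤ.- K ℤ.* (s ℤ.* (c ℤ.* x))
    regroup = solve-∀

k!*S≡sgn*Δ : ∀ n k → + (k ! ℕ.* S n k) ≡ sgn k ℤ.* Δ k (λ r → + (r ℕ.^ n))
k!*S≡sgn*Δ zero    zero    = refl
k!*S≡sgn*Δ zero    (suc k) = begin
  + (suc k ! ℕ.* 0)
    ≡⟨ cong +_ (ℕ.*-zeroʳ (suc k !)) ⟩
  ℤ.0ℤ
    ≡⟨ ℤ.*-zeroʳ (sgn (suc k)) ⟨
  sgn (suc k) ℤ.* ℤ.0ℤ
    ≡⟨ cong (sgn (suc k) ℤ.*_) (ℤ.+-inverseʳ (Δ k (λ _ → + 1))) ⟨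
  sgn (suc k) ℤ.* (Δ k (λ _ → + 1) ℤ.- Δ k (λ _ → + 1))
    ≡⟨ cong (sgn (suc k) ℤ.*_) (Δ-suc k (λ _ → + 1)) ⟨
  sgn (suc k) ℤ.* Δ (suc k) (λ _ → + 1) ∎
  where open ≡-Reasoning
k!*S≡sgn*Δ (suc n) zero    = refl
k!*S≡sgn*Δ (suc n) (suc k) = begin
  + (suc k ! ℕ.* S (suc n) (suc k))
    ≡⟨ cong +_ (recurrence (suc k) (k !) (S n k) (S n (suc k))) ⟩
  + (suc k ℕ.* (k ! ℕ.* S n k ℕ.+ suc k ! ℕ.* S n (suc k)))
    ≡⟨ trans (ℤ.pos-* (suc k) _) (cong (+ suc k ℤ.*_) (ℤ.pos-+ (k ! ℕ.* S n k) _)) ⟩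
  + suc k ℤ.* (+ (k ! ℕ.* S n k) ℤ.+ + (suc k ! ℕ.* S n (suc k)))
    ≡⟨ cong (+ suc k ℤ.*_) (cong₂ ℤ._+_ (k!*S≡sgn*Δ n k) (k!*S≡sgn*Δ n (suc k))) ⟩
  + suc k ℤ.* (sgn k ℤ.* Δ k g ℤ.+ sgn (suc k) ℤ.* Δ (suc k) g)
    ≡⟨ cong (λ d → + suc k ℤ.* (sgn k ℤ.* Δ k g ℤ.+ sgn (suc k) ℤ.* d)) (Δ-suc k g) ⟩
  + suc k ℤ.* (sgn k ℤ.* Δ k g ℤ.+ sgn (suc k) ℤ.* (Δ k g ℤ.- Δ k (g ∘ suc)))
    ≡⟨ regroup (sgn k) (+ suc k) (Δ k g) (Δ k (g ∘ suc)) ⟩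
  sgn (suc k) ℤ.* ℤ.- (+ suc k ℤ.* Δ k (g ∘ suc))
    ≡⟨ cong (sgn (suc k) ℤ.*_) (Δ-suc-*r k g) ⟨
  sgn (suc k) ℤ.* Δ (suc k) (λ r → + r ℤ.* g r)
    ≡⟨ cong (sgn (suc k) ℤ.*_) (Δ-cong (suc k) (λ r → ℤ.pos-* r (r ℕ.^ n))) ⟨
  sgn (suc k) ℤ.* Δ (suc k) (λ r → + (r ℕ.^ suc n)) ∎
  where
  open ≡-Reasoning
  g : ℕ → ℤ
  g r = + (r ℕ.^ n)
  recurrence : ∀ K f a b → K ℕ.* f ℕ.* (K ℕ.* b ℕ.+ a) ≡ K ℕ.* (f ℕ.* a ℕ.+ K ℕ.* f ℕ.* b)
  recurrence = ℕ-Solver.solve-∀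
  regroup : ∀ s K d d′ → K ℤ.* (s ℤ.* d ℤ.+ (ℤ.-1ℤ ℤ.* s) ℤ.* (d ℤ.- d′))
                        ≡ (ℤ.-1ℤ ℤ.* s) ℤ.* ℤ.- (K ℤ.* d′)
  regroup = solve-∀

toℚᵘ-/ : ∀ i n → toℚᵘ (i / suc n) ℚᵘ.≃ mkℚᵘ i n
toℚᵘ-/ i n = ℚ.toℚᵘ-fromℚᵘ (mkℚᵘ i n)

i/n+j/n≡[i+j]/n : ∀ i j n .{{_ : ℕ.NonZero n}} → i / n + j / n ≡ (i ℤ.+ j) / n
i/n+j/n≡[i+j]/n i j (suc n) = ℚ.toℚᵘ-injective (begin
  toℚᵘ (i / suc n + j / suc n)             ≈⟨ ℚ.toℚᵘ-homo-+ (i / suc n) (j / suc n) ⟩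
  toℚᵘ (i / suc n) ℚᵘ.+ toℚᵘ (j / suc n)   ≈⟨ ℚᵘ.+-cong (toℚᵘ-/ i n) (toℚᵘ-/ j n) ⟩
  mkℚᵘ i n ℚᵘ.+ mkℚᵘ j n                   ≈⟨ *≡* cross-multiplied ⟩
  mkℚᵘ (i ℤ.+ j) n                         ≈⟨ toℚᵘ-/ (i ℤ.+ j) n ⟨
  toℚᵘ ((i ℤ.+ j) / suc n)                 ∎)
  where
  open ℚᵘ.≃-Reasoning
  d = + suc n
  cross-multiplied : (i ℤ.* d ℤ.+ j ℤ.* d) ℤ.* d ≡ (i ℤ.+ j) ℤ.* + (suc n ℕ.* suc n)
  cross-multiplied = trans (identity i j d) (cong ((i ℤ.+ j) ℤ.*_) (ℤ.pos-* (suc n) (suc n)))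
    where
    identity : ∀ i j d → (i ℤ.* d ℤ.+ j ℤ.* d) ℤ.* d ≡ (i ℤ.+ j) ℤ.* (d ℤ.* d)
    identity = solve-∀

[i/n]*[j/1]≡[i*j]/n : ∀ i j n .{{_ : ℕ.NonZero n}} → (i / n) * (j / 1) ≡ (i ℤ.* j) / n
[i/n]*[j/1]≡[i*j]/n i j (suc n) = ℚ.toℚᵘ-injective (begin
  toℚᵘ ((i / suc n) * (j / 1))             ≈⟨ ℚ.toℚᵘ-homo-* (i / suc n) (j / 1) ⟩
  toℚᵘ (i / suc n) ℚᵘ.* toℚᵘ (j / 1)       ≈⟨ ℚᵘ.*-cong (toℚᵘ-/ i n) (toℚᵘ-/ j 0) ⟩
  mkℚᵘ i n ℚᵘ.* mkℚᵘ j 0                   ≈⟨ *≡* (cong (λ d → i ℤ.* j ℤ.* + d) (ℕ.*-identityʳ (suc n))) ⟨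
  mkℚᵘ (i ℤ.* j) n                         ≈⟨ toℚᵘ-/ (i ℤ.* j) n ⟨
  toℚᵘ ((i ℤ.* j) / suc n)                 ∎)
  where open ℚᵘ.≃-Reasoning

[n*i]/n≡i/1 : ∀ i n .{{_ : ℕ.NonZero n}} → (+ n ℤ.* i) / n ≡ i / 1
[n*i]/n≡i/1 i (suc n) = ℚ.toℚᵘ-injective (begin
  toℚᵘ ((+ suc n ℤ.* i) / suc n)           ≈⟨ toℚᵘ-/ (+ suc n ℤ.* i) n ⟩
  mkℚᵘ (+ suc n ℤ.* i) n                   ≈⟨ *≡* (swap (+ suc n) i) ⟩
  mkℚᵘ i 0                                 ≈⟨ toℚᵘ-/ i 0 ⟨
  toℚᵘ (i / 1)                             ∎)
  where
  open ℚᵘ.≃-Reasoning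
  swap : ∀ d i → d ℤ.* i ℤ.* ℤ.1ℤ ≡ i ℤ.* d
  swap = solve-∀

Σ₁-cong : ∀ k {f g : ℕ → ℚ} → (∀ r → f r ≡ g r) → Σ₁ k f ≡ Σ₁ k g
Σ₁-cong zero    f≡g = refl
Σ₁-cong (suc k) f≡g = cong₂ _+_ (Σ₁-cong k f≡g) (f≡g (suc k))

*-distribˡ-Σ₁ : ∀ k c f → c * Σ₁ k f ≡ Σ₁ k (λ r → c * f r)
*-distribˡ-Σ₁ zero    c f = ℚ.*-zeroʳ c
*-distribˡ-Σ₁ (suc k) c f =
  trans (ℚ.*-distribˡ-+ c (Σ₁ k f) (f (suc k))) (cong (_+ c * f (suc k)) (*-distribˡ-Σ₁ k c f))

Σ₁*Σ₁ : ∀ k l f g → Σ₁ k f * Σ₁ l g ≡ Σ₁ k (λ r → Σ₁ l (λ t → f r * g t))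
Σ₁*Σ₁ zero    l f g = ℚ.*-zeroˡ (Σ₁ l g)
Σ₁*Σ₁ (suc k) l f g =
  trans (ℚ.*-distribʳ-+ (Σ₁ l g) (Σ₁ k f) (f (suc k)))
        (cong₂ _+_ (Σ₁*Σ₁ k l f g) (*-distribˡ-Σ₁ l (f (suc k)) g))

Σ₁-/ : ∀ k n .{{_ : ℕ.NonZero n}} (g : ℕ → ℤ) → g 0 ≡ ℤ.0ℤ →
       Σ₁ k (λ r → g r / n) ≡ Σ₀ k g / n
Σ₁-/ zero    n g g0≡0 = trans (sym (ℚ.0/n≡0 n)) (cong (_/ n) (sym g0≡0))
Σ₁-/ (suc k) n g g0≡0 =
  trans (cong (_+ g (suc k) / n) (Σ₁-/ k n g g0≡0)) (i/n+j/n≡[i+j]/n (Σ₀ k g) (g (suc k)) n)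

[-1]^[k∸r]≡sgn[k]*sgn[r] : ∀ k r → r ≤ k → (ℤ.- ℤ.1ℤ) ℤ.^ (k ∸ r) ≡ sgn k ℤ.* sgn r
[-1]^[k∸r]≡sgn[k]*sgn[r] k       zero    _         = sym (ℤ.*-identityʳ (sgn k))
[-1]^[k∸r]≡sgn[k]*sgn[r] (suc k) (suc r) (s≤s r≤k) =
  trans ([-1]^[k∸r]≡sgn[k]*sgn[r] k r r≤k) (sign-square (sgn k) (sgn r))
  where
  sign-square : ∀ a b → a ℤ.* b ≡ (ℤ.-1ℤ ℤ.* a) ℤ.* (ℤ.-1ℤ ℤ.* b)
  sign-square = solve-∀

A-numerator*pow : ∀ k r m → r ≤ k →
  (ℤ.- ℤ.1ℤ) ℤ.^ (k ∸ r) ℤ.* + (r ℕ.^ k ℕ.* (k C r)) ℤ.* + (r ℕ.^ m)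
    ≡ sgn k ℤ.* (sgn r ℤ.* (+ (k C r) ℤ.* + (r ℕ.^ (m ℕ.+ k))))
A-numerator*pow k r m r≤k = begin
  (ℤ.- ℤ.1ℤ) ℤ.^ (k ∸ r) ℤ.* + (r ℕ.^ k ℕ.* (k C r)) ℤ.* + (r ℕ.^ m)
    ≡⟨ cong₂ (λ σ c → σ ℤ.* c ℤ.* + (r ℕ.^ m))
             ([-1]^[k∸r]≡sgn[k]*sgn[r] k r r≤k) (ℤ.pos-* (r ℕ.^ k) (k C r)) ⟩
  sgn k ℤ.* sgn r ℤ.* (+ (r ℕ.^ k) ℤ.* + (k C r)) ℤ.* + (r ℕ.^ m)
    ≡⟨ regroup (sgn k) (sgn r) (+ (r ℕ.^ k)) (+ (k C r)) (+ (r ℕ.^ m)) ⟩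
  sgn k ℤ.* (sgn r ℤ.* (+ (k C r) ℤ.* (+ (r ℕ.^ m) ℤ.* + (r ℕ.^ k))))
    ≡⟨ cong (λ p → sgn k ℤ.* (sgn r ℤ.* (+ (k C r) ℤ.* p))) (ℤ.pos-* (r ℕ.^ m) (r ℕ.^ k)) ⟨
  sgn k ℤ.* (sgn r ℤ.* (+ (k C r) ℤ.* + (r ℕ.^ m ℕ.* r ℕ.^ k)))
    ≡⟨ cong (λ p → sgn k ℤ.* (sgn r ℤ.* (+ (k C r) ℤ.* + p))) (ℕ.^-distribˡ-+-* r m k) ⟨
  sgn k ℤ.* (sgn r ℤ.* (+ (k C r) ℤ.* + (r ℕ.^ (m ℕ.+ k)))) ∎
  where
  open ≡-Reasoning
  regroup : ∀ σ ρ p c q → σ ℤ.* ρ ℤ.* (p ℤ.* c) ℤ.* q ≡ σ ℤ.* (ρ ℤ.* (c ℤ.* (q ℤ.* p)))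
  regroup = solve-∀

S-via-A : ∀ k m →
  Σ₁ (suc k) (λ r → A (suc k) r * (+ (r ℕ.^ m) / 1)) ≡ + S (m ℕ.+ suc k) (suc k) / 1
S-via-A k m = begin
  Σ₁ K (λ r → A K r * (+ (r ℕ.^ m) / 1))
    ≡⟨ Σ₁-cong K (λ r → [i/n]*[j/1]≡[i*j]/n (a r) (+ (r ℕ.^ m)) (K !)) ⟩
  Σ₁ K (λ r → (a r ℤ.* + (r ℕ.^ m)) / K !)
    ≡⟨ Σ₁-/ K (K !) (λ r → a r ℤ.* + (r ℕ.^ m)) zero-term ⟩
  Σ₀ K (λ r → a r ℤ.* + (r ℕ.^ m)) / K !
    ≡⟨ cong (_/ K !) (Σ₀-cong K (λ r r≤K → A-numerator*pow K r m r≤K)) ⟩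
  Σ₀ K (λ r → sgn K ℤ.* (sgn r ℤ.* (+ (K C r) ℤ.* + (r ℕ.^ N)))) / K !
    ≡⟨ cong (_/ K !) (*-distribˡ-Σ₀ K (sgn K) _) ⟨
  (sgn K ℤ.* Δ K (λ r → + (r ℕ.^ N))) / K !
    ≡⟨ cong (_/ K !) (k!*S≡sgn*Δ N K) ⟨
  + (K ! ℕ.* S N K) / K !
    ≡⟨ cong (_/ K !) (ℤ.pos-* (K !) (S N K)) ⟩
  (+ (K !) ℤ.* + S N K) / K !
    ≡⟨ [n*i]/n≡i/1 (+ S N K) (K !) ⟩
  + S N K / 1 ∎
  where
  open ≡-Reasoning
  K = suc k
  N = m ℕ.+ K
  instance _ = K !≢0
  a : ℕ → ℤ
  a r = (ℤ.- ℤ.1ℤ) ℤ.^ (K ∸ r) ℤ.* + (r ℕ.^ K ℕ.* (K C r))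
  zero-term : a 0 ℤ.* + (0 ℕ.^ m) ≡ ℤ.0ℤ
  zero-term = trans (cong (ℤ._* + (0 ℕ.^ m)) (ℤ.*-zeroʳ ((ℤ.- ℤ.1ℤ) ℤ.^ K)))
                    (ℤ.*-zeroˡ (+ (0 ℕ.^ m)))

S²-via-A : ∀ k m →
  + (S (m ℕ.+ suc k) (suc k) ℕ.* S (m ℕ.+ suc k) (suc k)) / 1
    ≡ Σ₁ (suc k) (λ r → Σ₁ (suc k) (λ t → (A (suc k) r * A (suc k) t) * (+ ((r ℕ.* t) ℕ.^ m) / 1)))
S²-via-A k m = begin
  + (S N K ℕ.* S N K) / 1
    ≡⟨ cong (_/ 1) (ℤ.pos-* (S N K) (S N K)) ⟩
  (+ S N K ℤ.* + S N K) / 1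
    ≡⟨ [i/n]*[j/1]≡[i*j]/n (+ S N K) (+ S N K) 1 ⟨
  (+ S N K / 1) * (+ S N K / 1)
    ≡⟨ cong₂ _*_ (S-via-A k m) (S-via-A k m) ⟨
  Σ₁ K F * Σ₁ K F
    ≡⟨ Σ₁*Σ₁ K K F F ⟩
  Σ₁ K (λ r → Σ₁ K (λ t → F r * F t))
    ≡⟨ Σ₁-cong K (λ r → Σ₁-cong K (λ t → split r t)) ⟨
  Σ₁ K (λ r → Σ₁ K (λ t → (A K r * A K t) * pow (r ℕ.* t))) ∎
  where
  open ≡-Reasoning
  K = suc k
  N = m ℕ.+ K
  pow : ℕ → ℚ
  pow r = + (r ℕ.^ m) / 1
  F : ℕ → ℚ
  F r = A K r * pow r
  open CommSemigroup (CommutativeMonoid.commutativeSemigroup ℚ.*-1-commutativeMonoid) using (interchange)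
  split : ∀ r t → (A K r * A K t) * pow (r ℕ.* t) ≡ F r * F t
  split r t = begin
    (A K r * A K t) * pow (r ℕ.* t)
      ≡⟨ cong (λ p → (A K r * A K t) * (p / 1))
              (trans (cong +_ (^-distribʳ-* r t m)) (ℤ.pos-* (r ℕ.^ m) (t ℕ.^ m))) ⟩
    (A K r * A K t) * ((+ (r ℕ.^ m) ℤ.* + (t ℕ.^ m)) / 1)
      ≡⟨ cong ((A K r * A K t) *_) ([i/n]*[j/1]≡[i*j]/n (+ (r ℕ.^ m)) (+ (t ℕ.^ m)) 1) ⟨
    (A K r * A K t) * (pow r * pow t)
      ≡⟨ interchange (A K r) (A K t) (pow r) (pow t) ⟩
    F r * F t ∎

shiftX-cong : ∀ k {f g : Series} → (∀ m → f m ≡ g m) → ∀ n → shiftX k f n ≡ shiftX k g n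
shiftX-cong zero    f≡g n       = f≡g n
shiftX-cong (suc k) f≡g zero    = refl
shiftX-cong (suc k) f≡g (suc n) = shiftX-cong k f≡g n

mainTheorem1 : (k : ℕ) → 1 ≤ k → (n : ℕ) → lhsSeries k n ≡ rhsSeries k n
mainTheorem1 (suc k) _ = shiftX-cong (suc k) (S²-via-A k)
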